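{- Let $\mathrm{p}:V\to V$ be parent pointers on a finite set $V$ with a unique root, with $d=\mathrm{dep}(\mathrm{p})\ge 2$, and let $Q=\{(u_1,v_1),\dots,(u_q,v_q)\}\subseteq V\times V$ with $v_j$ an ancestor of $u_j$ for every $j$. Run the following procedure $\textsc{MultiPaths}(\mathrm{p},Q)$. Let $t=\lceil\log d\rceil$, $V'=\{v:\mathrm{dep}_{\mathrm{p}}(v)\equiv0\pmod t,\ \mathrm{dep}_{\mathrm{p}}(v)+t\le d\}$, $\mathrm{p}'(v)=\mathrm{p}^{(t)}(v)$ on $V'$, $g_k(v)=\mathrm{p}'^{(2^k)}(v)$ for $0\le k\le t$. For each $(u_i,v_i)\in Q$: (a) if $\mathrm{dep}_{\mathrm{p}}(u_i)-\mathrm{dep}_{\mathrm{p}}(v_i)\le 2t$, output $P_i=(u_i,\mathrm{p}^{(1)}(u_i),\mathrm{p}^{(2)}(u_i),\dots,v_i)$; (b) otherwise let $u_i'=\mathrm{p}^{(j)}(u_i)$ for the minimum $j\in\{1,\dots,2t\}$ with $\mathrm{p}^{(j)}(u_i)\in V'$; compute $v_i'$ by initializing $v_i'\gets u_i'$ and, for $k=t,t-1,\dots,0$, setting $v_i'\gets g_k(v_i')$ whenever $\mathrm{dep}_{\mathrm{p}}(g_k(v_i'))>\mathrm{dep}_{\mathrm{p}}(v_i)$; (c) let $P'(u_i',v_i')=(u_i',\mathrm{p}'(u_i'),\mathrm{p}'^{(2)}(u_i'),\dots,v_i')$ be the path in $\mathrm{p}'$; (d) let $A$ be the concatenation of $(u_i)$,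 $P'(u_i',v_i')$ and $(v_i)$; (e) repeat: for each element $a_k$ of $A$ that is not the last and satisfies $a_{k+1}\ne\mathrm{p}(a_k)$, insert $\mathrm{p}(a_k)$ between $a_k$ and $a_{k+1}$; until $A$ does not change; output $P_i=A$. Then for every $j\in[q]$, $P_j=P(u_j,v_j)=(u_j,\mathrm{p}(u_j),\mathrm{p}^{(2)}(u_j),\dots,v_j)$, the path from $u_j$ to $v_j$ in $\mathrm{p}$.
   Context: Parent pointers: $\mathrm{p}^{(0)}(v)=v$, $\mathrm{p}^{(i)}(v)=\mathrm{p}(\mathrm{p}^{(i-1)}(v))$, every vertex eventually reaches a fixed point (root, $\mathrm{p}(r)=r$). $\mathrm{dep}_{\mathrm{p}}(v)$ is the smallest $i\ge0$ with $\mathrm{p}^{(i)}(v)=\mathrm{p}^{(i+1)}(v)$; $\mathrm{dep}(\mathrm{p})=\max_v\mathrm{dep}_{\mathrm{p}}(v)$. $u$ is an ancestor of $v$ if $u=\mathrm{p}^{(i)}(v)$ for some $i\ge0$; the path $P(v,u)$ from $v$ to its ancestor $u$ is $(v,\mathrm{p}(v),\mathrm{p}^{(2)}(v),\dots,u)$. Logarithms are base 2. -}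

module Defs where

open import Data.Nat using (ℕ; zero; suc; _+_; _*_; _∸_; _^_; _≤_; _<_; _⊔_; _≤?_)
open import Data.Nat.Divisibility using (_∣?_)
open import Data.Nat.Logarithm using (⌈log₂_⌉)
open import Data.Fin using (Fin) renaming (_≟_ to _≟ᶠ_)
open import Data.Bool using (Bool; true; false; if_then_else_; _∧_)
open import Data.List using (List; []; _∷_; _++_; map; upTo; foldr; allFin)
open import Data.Product using (_×_; ∃)
open import Relation.Nullary using (¬_)
open import Relation.Nullary.Decidable using (⌊_⌋)
open import Relation.Binary.PropositionalEquality using (_≡_)

iter : {A : Set} → (A → A) → ℕ → A → A
iter f zero    v = v
iter f (suc i) v = f (iter f i v)

-- least i in {s, s+1, ..., s+fuel-1} with P i; default s+fuel if none
searchFrom : (P : ℕ → Bool) → ℕ → ℕ → ℕ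
searchFrom P s zero       = s
searchFrom P s (suc fuel) = if P s then s else searchFrom P (suc s) fuel

module Procedure {n : ℕ} (p : Fin n → Fin n) where

  eqᶠ : Fin n → Fin n → Bool
  eqᶠ a b = ⌊ a ≟ᶠ b ⌋

  -- dep_p(v): smallest i ≥ 0 with p^(i)(v) = p^(i+1)(v).
  -- Under the standing assumption (every vertex reaches a root) such i ≤ n exists,
  -- so a search over 0..n computes it exactly.
  dep : Fin n → ℕ
  dep v = searchFrom (λ i → eqᶠ (iter p i v) (iter p (suc i) v)) 0 (suc n)

  depth : ℕ
  depth = foldr _⊔_ 0 (map dep (allFin n))

  -- generic path (x, f x, f^2 x, ..., y) in pointer structure f, stopping at the
  -- first occurrence of y (search bounded by n, enough when y is an f-ancestor of x)
  pathIn : (Fin n → Fin n) → Fin n → Fin n → List (Fin n)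
  pathIn f x y = map (λ i → iter f i x) (upTo (suc k))
    where k = searchFrom (λ i → eqᶠ (iter f i x) y) 0 (suc n)

  t : ℕ
  t = ⌈log₂ depth ⌉

  inV' : Fin n → Bool
  inV' v = ⌊ t ∣? dep v ⌋ ∧ ⌊ dep v + t ≤? depth ⌋

  p' : Fin n → Fin n
  p' = iter p t

  g : ℕ → Fin n → Fin n
  g k = iter p' (2 ^ k)

  u'of : Fin n → Fin n
  u'of u = iter p (searchFrom (λ j → inV' (iter p j u)) 1 (2 * t)) u

  jumpStep : Fin n → ℕ → Fin n → Fin n
  jumpStep v k w = if ⌊ suc (dep v) ≤? dep (g k w) ⌋ then g k w else w

  -- loop performing the updates for k = m-1, m-2, ..., 0 (in that order)
  jumpLoop : Fin n → ℕ → Fin n → Fin n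
  jumpLoop v zero    w = w
  jumpLoop v (suc m) w = jumpLoop v m (jumpStep v m w)

  v'of : Fin n → Fin n → Fin n
  v'of u v = jumpLoop v (suc t) (u'of u)

  initialA : Fin n → Fin n → List (Fin n)
  initialA u v = (u ∷ []) ++ pathIn p' (u'of u) (v'of u v) ++ (v ∷ [])

  insertPass : List (Fin n) → List (Fin n)
  insertPass []           = []
  insertPass (a ∷ [])     = a ∷ []
  insertPass (a ∷ b ∷ as) =
    if eqᶠ b (p a) then a ∷ insertPass (b ∷ as)
                   else a ∷ p a ∷ insertPass (b ∷ as)

  -- "repeat insertPass until A does not change" terminates with result B
  data RepeatUntilStable : List (Fin n) → List (Fin n) → Set where
    stable : ∀ {A} → insertPass A ≡ A → RepeatUntilStable A A
    again  : ∀ {A B} → ¬ (insertPass A ≡ A) →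
             RepeatUntilStable (insertPass A) B → RepeatUntilStable A B

  data MultiPathsOut (u v : Fin n) : List (Fin n) → Set where
    caseA : dep u ∸ dep v ≤ 2 * t →
            MultiPathsOut u v (pathIn p u v)
    caseB : ∀ {P} → ¬ (dep u ∸ dep v ≤ 2 * t) →
            RepeatUntilStable (initialA u v) P →
            MultiPathsOut u v P

-- Write c x = p^(x)(u) and let K be least with c K = v. Along the orbit of u the
-- depth drops by one per step, dep (c x) = dep u ∸ x, so dep u ∸ dep v = K and
-- c 0, …, c K are pairwise distinct. In case (b) every vertex put into A is c x
-- for some x < K: u' = c j with 1 ≤ j < K, because the offset j₀ = t + dep u % t
-- lies in [t, 2t) and puts c j₀ into V'; and a jump is accepted only when it lands
-- strictly deeper than v. Hence A = map c l for a strictly increasing index list l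
-- from 0 to K. A pass of (e) inserts c (x + 1) exactly after those x whose
-- successor index is not x + 1, which lowers the largest gap by one, and A is
-- stable exactly when l = 0, 1, …, K.
module Submission where

open import Defs
open import Data.Nat
open import Data.Nat.Properties
open import Data.Nat.DivMod using (_/_; _%_; m%n<n; m≡m%n+[m/n]*n)
open import Data.Nat.Divisibility using (_∣_; divides; _∣?_)
open import Data.Nat.Logarithm using (⌈log₂⌉-mono-≤)
open import Data.Fin using (Fin; toℕ) renaming (_≟_ to _≟ᶠ_)
open import Data.Fin.Properties using (pigeonhole; toℕ<n)
open import Data.Bool using (Bool; true; false; if_then_else_)
open import Data.List using (List; []; _∷_; _++_; map; upTo; applyUpTo; length; foldr; allFin)
open import Data.List.Properties using (map-upTo; map-applyUpTo; map-cong; map-++; length-map; ≡-dec)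
open import Data.List.Membership.Propositional using (_∈_)
open import Data.List.Membership.Propositional.Properties using (∈-allFin)
open import Data.List.Relation.Unary.Any using (here; there)
open import Data.Product using (∃; _×_; _,_; proj₁; proj₂)
open import Data.Sum using (inj₁; inj₂)
open import Function using (_∘_)
open import Relation.Nullary using (¬_; yes; no; contradiction)
open import Relation.Nullary.Decidable using (Dec; ⌊_⌋; isYes≗does; dec-true; dec-false)
open import Relation.Unary using (Decidable)
open import Relation.Binary.PropositionalEquality

private
  variable
    A : Set

iter-+ : (f : A → A) (a b : ℕ) (x : A) → iter f a (iter f b x) ≡ iter f (a + b) x
iter-+ f zero    b x = refl
iter-+ f (suc a) b x = cong f (iter-+ f a b x)

iter-* : (f : A → A) (t i : ℕ) (x : A) → iter (iter f t) i x ≡ iter f (i * t) x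
iter-* f t zero    x = refl
iter-* f t (suc i) x = trans (cong (iter f t) (iter-* f t i x)) (iter-+ f t (i * t) x)

iter-fixed : (f : A → A) (x : A) {r e : ℕ} →
             iter f r x ≡ iter f (suc r) x → r ≤ e → iter f e x ≡ iter f r x
iter-fixed f x {r} {e} fixed r≤e =
  trans (cong (λ i → iter f i x) (sym (m∸n+n≡m r≤e))) (beyond (e ∸ r))
  where
  beyond : ∀ k → iter f (k + r) x ≡ iter f r x
  beyond zero    = refl
  beyond (suc k) = trans (cong f (beyond k)) (sym fixed)

iter-periodic : (f : A → A) (x : A) {s d : ℕ} →
                iter f s x ≡ iter f (d + s) x → ∀ c → iter f (c * d + s) x ≡ iter f s x
iter-periodic f x         period zero    = refl
iter-periodic f x {s} {d} period (suc c) = begin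
  iter f (d + c * d + s) x        ≡⟨ cong (λ i → iter f i x) (+-assoc d (c * d) s) ⟩
  iter f (d + (c * d + s)) x      ≡⟨ iter-+ f d (c * d + s) x ⟨
  iter f d (iter f (c * d + s) x) ≡⟨ cong (iter f d) (iter-periodic f x period c) ⟩
  iter f d (iter f s x)           ≡⟨ iter-+ f d s x ⟩
  iter f (d + s) x                ≡⟨ period ⟨
  iter f s x                      ∎
  where open ≡-Reasoning

isYes-true : (a? : Dec A) → A → ⌊ a? ⌋ ≡ true
isYes-true a? a = trans (isYes≗does a?) (dec-true a? a)

isYes-false : (a? : Dec A) → ¬ A → ⌊ a? ⌋ ≡ false
isYes-false a? ¬a = trans (isYes≗does a?) (dec-false a? ¬a)

Least : (ℕ → Set) → ℕ → Set
Least P m = P m × (∀ k → k < m → ¬ P k)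

least-witness : {P : ℕ → Set} → Decidable P → ∀ i → P i → ∃ (Least P)
least-witness P? i Pi with P? 0
... | yes P0 = 0 , P0 , λ _ ()
least-witness P? zero    Pi | no ¬P0 = contradiction Pi ¬P0
least-witness P? (suc i) Pi | no ¬P0 with least-witness (P? ∘ suc) i Pi
... | m , Pm , below = suc m , Pm , λ { zero _ → ¬P0 ; (suc k) k<m → below k (s<s⁻¹ k<m) }

searchFrom-≥ : (P : ℕ → Bool) (s f : ℕ) → s ≤ searchFrom P s f
searchFrom-≥ P s zero    = ≤-refl
searchFrom-≥ P s (suc f) with P s
... | true  = ≤-refl
... | false = ≤-trans (n≤1+n s) (searchFrom-≥ P (suc s) f)

searchFrom-≤ : (P : ℕ → Bool) {s f i : ℕ} → P i ≡ true → s ≤ i → i < s + f → searchFrom P s f ≤ i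
searchFrom-≤ P {s} {zero} _ s≤i i<s+0 = contradiction (subst (_ <_) (+-identityʳ s) i<s+0) (≤⇒≯ s≤i)
searchFrom-≤ P {s} {suc f} {i} Pi s≤i i<s+f with P s in Ps | m≤n⇒m<n∨m≡n s≤i
... | true  | _        = s≤i
... | false | inj₁ s<i = searchFrom-≤ P Pi s<i (subst (i <_) (+-suc s f) i<s+f)
... | false | inj₂ refl = contradiction (trans (sym Pi) Ps) λ ()

searchFrom-≡ : (P : ℕ → Bool) {s f i : ℕ} → P i ≡ true → (∀ k → s ≤ k → k < i → P k ≡ false) →
               s ≤ i → i < s + f → searchFrom P s f ≡ i
searchFrom-≡ P {s} {zero} _ _ s≤i i<s+0 = contradiction (subst (_ <_) (+-identityʳ s) i<s+0) (≤⇒≯ s≤i)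
searchFrom-≡ P {s} {suc f} {i} Pi before s≤i i<s+f with m≤n⇒m<n∨m≡n s≤i
... | inj₂ refl rewrite Pi = refl
... | inj₁ s<i rewrite before s ≤-refl s<i =
  searchFrom-≡ P Pi (λ k s<k → before k (<⇒≤ s<k)) s<i (subst (i <_) (+-suc s f) i<s+f)

searchFrom-least : {Q : ℕ → Set} (Q? : Decidable Q) {m f : ℕ} →
                   Least Q m → m < f → searchFrom (λ i → ⌊ Q? i ⌋) 0 f ≡ m
searchFrom-least Q? (Qm , below) m<f =
  searchFrom-≡ _ (isYes-true (Q? _) Qm) (λ k _ k<m → isYes-false (Q? k) (below k k<m)) z≤n m<f

∈⇒≤-foldr-⊔ : (f : A → ℕ) {x : A} (xs : List A) → x ∈ xs → f x ≤ foldr _⊔_ 0 (map f xs)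
∈⇒≤-foldr-⊔ f (y ∷ xs) (here refl) = m≤m⊔n (f y) _
∈⇒≤-foldr-⊔ f (y ∷ xs) (there x∈xs) = ≤-trans (∈⇒≤-foldr-⊔ f xs x∈xs) (m≤n⊔m (f y) _)

n∣m∸[n+m%n] : ∀ m n .{{_ : NonZero n}} → n ∣ m ∸ (n + m % n)
n∣m∸[n+m%n] m n = divides (m / n ∸ 1) (begin
  m ∸ (n + m % n)                 ≡⟨ cong (m ∸_) (+-comm n (m % n)) ⟩
  m ∸ (m % n + n)                 ≡⟨ ∸-+-assoc m (m % n) n ⟨
  m ∸ m % n ∸ n                   ≡⟨ cong (λ k → k ∸ m % n ∸ n) (m≡m%n+[m/n]*n m n) ⟩
  m % n + m / n * n ∸ m % n ∸ n   ≡⟨ cong (_∸ n) (m+n∸m≡n (m % n) (m / n * n)) ⟩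
  m / n * n ∸ n                   ≡⟨ cong (m / n * n ∸_) (*-identityˡ n) ⟨
  m / n * n ∸ 1 * n               ≡⟨ *-distribʳ-∸ n (m / n) 1 ⟨
  (m / n ∸ 1) * n                 ∎)
  where open ≡-Reasoning

module Orbit {n : ℕ} (p : Fin n → Fin n)
             (reaches-root : ∀ v → ∃ λ i → p (iter p i v) ≡ iter p i v) where

  open Procedure p using (dep)

  Settled : Fin n → ℕ → Set
  Settled w m = iter p m w ≡ iter p (suc m) w

  settled? : ∀ w → Decidable (Settled w)
  settled? w m = iter p m w ≟ᶠ iter p (suc m) w

  settled-at : ∀ w i w' j → iter p i w ≡ iter p j w' → Settled w' j → Settled w i
  settled-at _ _ _ _ same settled = trans same (trans settled (cong p (sym same)))

  least-settled : ∀ w → ∃ (Least (Settled w))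
  least-settled w = least-witness (settled? w) (proj₁ (reaches-root w)) (sym (proj₂ (reaches-root w)))

  repeat⇒settled : ∀ w {x y} → x < y → iter p x w ≡ iter p y w → Settled w x
  repeat⇒settled w {x} {y} x<y repeat = settled-at w x w r x↦r (sym root)
    where
    r    = proj₁ (reaches-root w)
    root = proj₂ (reaches-root w)
    d    = y ∸ x
    period : iter p x w ≡ iter p (d + x) w
    period = trans repeat (cong (λ i → iter p i w) (sym (m∸n+n≡m (<⇒≤ x<y))))
    r≤ : r ≤ r * d + x
    r≤ = ≤-trans (m≤m*n r d {{>-nonZero (m<n⇒0<n∸m x<y)}}) (m≤m+n (r * d) x)
    x↦r : iter p x w ≡ iter p r w
    x↦r = trans (sym (iter-periodic p w period r)) (iter-fixed p w (sym root) r≤)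

  settled-below-n : ∀ w {m} → Least (Settled w) m → m < n
  settled-below-n w {m} (_ , unsettled) with m <? n
  ... | yes m<n = m<n
  ... | no m≮n with pigeonhole (≰⇒> m≮n) (λ (i : Fin (suc m)) → iter p (toℕ i) w)
  ...   | i , j , i<j , repeat =
    contradiction (repeat⇒settled w i<j repeat) (unsettled (toℕ i) (<-≤-trans i<j (s≤s⁻¹ (toℕ<n j))))

  dep-least : ∀ w {m} → Least (Settled w) m → dep w ≡ m
  dep-least w least = searchFrom-least (settled? w) least (m<n⇒m<1+n (settled-below-n w least))

module Climb {n : ℕ} (p : Fin n → Fin n)
             (reaches-root : ∀ v → ∃ λ i → p (iter p i v) ≡ iter p i v)
             (u v : Fin n) (v-ancestor : ∃ λ i → iter p i u ≡ v) where

  open Procedure p using (dep; pathIn)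
  open Orbit p reaches-root

  climb : ℕ → Fin n
  climb x = iter p x u

  D : ℕ
  D = proj₁ (least-settled u)

  D-least : Least (Settled u) D
  D-least = proj₂ (least-settled u)

  climb-settles : ∀ {e} → D ≤ e → climb e ≡ climb D
  climb-settles = iter-fixed p u (proj₁ D-least)

  dep-climb : ∀ x → dep (climb x) ≡ D ∸ x
  dep-climb x = dep-least (climb x) (settled , unsettled)
    where
    shift : ∀ k → iter p k (climb x) ≡ climb (k + x)
    shift k = iter-+ p k x u
    settled : Settled (climb x) (D ∸ x)
    settled = settled-at (climb x) (D ∸ x) u D (trans (shift (D ∸ x)) (climb-settles D≤D∸x+x)) (proj₁ D-least)
      where D≤D∸x+x = ≤-trans (m≤n+m∸n D x) (≤-reflexive (+-comm x (D ∸ x)))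
    unsettled : ∀ k → k < D ∸ x → ¬ Settled (climb x) k
    unsettled k k<D∸x = proj₂ D-least (k + x) k+x<D ∘ settled-at u (k + x) (climb x) k (sym (shift k))
      where
      x<D : x < D
      x<D = m∸n≢0⇒n<m (λ D∸x≡0 → contradiction (subst (k <_) D∸x≡0 k<D∸x) λ ())
      k+x<D = m≤o∸n⇒m+n≤o (suc k) (<⇒≤ x<D) k<D∸x

  K-data : ∃ (Least (λ i → climb i ≡ v))
  K-data = least-witness (λ i → climb i ≟ᶠ v) (proj₁ v-ancestor) (proj₂ v-ancestor)

  K : ℕ
  K = proj₁ K-data

  climb-K : climb K ≡ v
  climb-K = proj₁ (proj₂ K-data)

  K-first : ∀ k → k < K → climb k ≢ v
  K-first = proj₂ (proj₂ K-data)

  K≤D : K ≤ D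
  K≤D = ≮⇒≥ λ D<K → K-first D D<K (trans (sym (climb-settles (<⇒≤ D<K))) climb-K)

  K<n : K < n
  K<n = ≤-<-trans K≤D (settled-below-n u D-least)

  dep-v : dep v ≡ D ∸ K
  dep-v = trans (cong dep (sym climb-K)) (dep-climb K)

  dep-u∸dep-v : dep u ∸ dep v ≡ K
  dep-u∸dep-v = trans (cong₂ _∸_ (dep-climb 0) dep-v) (m∸[m∸n]≡n K≤D)

  climb-injective : ∀ {x y} → x < y → y ≤ K → climb x ≢ climb y
  climb-injective {x} x<y y≤K repeat =
    K-first x x<K (trans (sym (iter-fixed p u (repeat⇒settled u x<y repeat) (<⇒≤ x<K))) climb-K)
    where x<K = <-≤-trans x<y y≤K

  pathIn-climb : pathIn p u v ≡ map climb (upTo (suc K))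
  pathIn-climb = cong (λ k → map climb (upTo (suc k)))
    (searchFrom-least (λ i → climb i ≟ᶠ v) (proj₂ K-data) (m<n⇒m<1+n K<n))

  deeper-than-v⇒below-K : ∀ e → dep v < dep (climb e) → e < K
  deeper-than-v⇒below-K e deeper = ≰⇒> λ K≤e →
    <⇒≱ deeper (subst₂ _≤_ (sym (dep-climb e)) (sym dep-v) (∸-monoʳ-≤ D K≤e))

-- Strictly increasing index lists from x to z with consecutive gaps at most
-- N + 1; each fillGaps pass lowers N by one, which bounds the passes of (e).
data Ascending (N : ℕ) : ℕ → ℕ → List ℕ → Set where
  single : ∀ {x} → Ascending N x x (x ∷ [])
  step   : ∀ {x y z l} → x < y → y ≤ x + suc N → Ascending N y z l → Ascending N x z (x ∷ l)

fillGaps : List ℕ → List ℕ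
fillGaps []          = []
fillGaps (x ∷ [])    = x ∷ []
fillGaps (x ∷ y ∷ l) = if ⌊ y ≟ suc x ⌋ then x ∷ fillGaps (y ∷ l) else x ∷ suc x ∷ fillGaps (y ∷ l)

ascending-head : ∀ {N x z w l} → Ascending N x z (w ∷ l) → w ≡ x
ascending-head single       = refl
ascending-head (step _ _ _) = refl

ascending-≤ : ∀ {N x z l} → Ascending N x z l → x ≤ z
ascending-≤ single            = ≤-refl
ascending-≤ (step x<y _ rest) = ≤-trans (<⇒≤ x<y) (ascending-≤ rest)

unit-gap : ∀ {x y} → x < y → y ≤ x + 1 → y ≡ suc x
unit-gap {x} {y} x<y gap = ≤-antisym (subst (y ≤_) (+-comm x 1) gap) x<y

fillGaps-narrows : ∀ {N x z l} → Ascending (suc N) x z l → Ascending N x z (fillGaps l)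
fillGaps-narrows single = single
fillGaps-narrows (step {l = []} _ _ ())
fillGaps-narrows {N} (step {x = x} {y} {l = _ ∷ _} x<y gap rest) with ascending-head rest
... | refl with y ≟ suc x
... | yes refl = step x<y (m<m+n x z<s) (fillGaps-narrows rest)
... | no y≢1+x = step (n<1+n x) (m<m+n x z<s)
                   (step (≤∧≢⇒< x<y (y≢1+x ∘ sym)) (subst (y ≤_) (+-suc x (suc N)) gap) (fillGaps-narrows rest))

fillGaps-unit : ∀ {x z l} → Ascending 0 x z l → fillGaps l ≡ l
fillGaps-unit single = refl
fillGaps-unit (step {l = []} _ _ ())
fillGaps-unit (step {x = x} {y} {l = _ ∷ _} x<y gap rest) with ascending-head rest
... | refl with y ≟ suc x
... | yes refl = cong (x ∷_) (fillGaps-unit rest)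
... | no y≢1+x = contradiction (unit-gap x<y gap) y≢1+x

length-fillGaps : ∀ l → length l ≤ length (fillGaps l)
length-fillGaps []          = z≤n
length-fillGaps (x ∷ [])    = ≤-refl
length-fillGaps (x ∷ y ∷ l) = grows ⌊ y ≟ suc x ⌋ (length-fillGaps (y ∷ l))
  where
  grows : ∀ b → length (y ∷ l) ≤ length (fillGaps (y ∷ l)) →
          length (x ∷ y ∷ l) ≤ length (if b then x ∷ fillGaps (y ∷ l) else x ∷ suc x ∷ fillGaps (y ∷ l))
  grows true  le = s≤s le
  grows false le = s≤s (m≤n⇒m≤1+n le)

fillGaps-length-≡ : ∀ {N x z l} → Ascending N x z l → length (fillGaps l) ≡ length l → Ascending 0 x z l
fillGaps-length-≡ single _ = single
fillGaps-length-≡ (step {l = []} _ _ ())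
fillGaps-length-≡ (step {x = x} {y} {l = _ ∷ l} x<y _ rest) same with ascending-head rest
... | refl with y ≟ suc x
... | yes refl = step x<y (≤-reflexive (+-comm 1 x)) (fillGaps-length-≡ rest (suc-injective same))
... | no _     = contradiction (length-fillGaps (y ∷ l)) (<⇒≱ (≤-reflexive (suc-injective same)))

applyUpTo-cong : ∀ {f g : ℕ → A} → (∀ i → f i ≡ g i) → ∀ k → applyUpTo f k ≡ applyUpTo g k
applyUpTo-cong {f = f} {g} f≗g k =
  trans (sym (map-upTo f k)) (trans (map-cong f≗g (upTo k)) (map-upTo g k))

ascending-unit-range : ∀ {x z l} → Ascending 0 x z l → l ≡ applyUpTo (x +_) (suc (z ∸ x))
ascending-unit-range {x} single rewrite n∸n≡0 x = cong (_∷ []) (sym (+-identityʳ x))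
ascending-unit-range {x} {z} (step x<y gap rest) with unit-gap x<y gap
... | refl rewrite ascending-unit-range rest | +-∸-assoc 1 (ascending-≤ rest) =
  cong₂ _∷_ (sym (+-identityʳ x)) (applyUpTo-cong (λ i → sym (+-suc x i)) (suc (z ∸ suc x)))

ascending-cons : ∀ {K x y l} → x < y → Ascending K y K l → Ascending K x K (x ∷ l)
ascending-cons {K} {x} x<y rest =
  step x<y (≤-trans (ascending-≤ rest) (≤-trans (n≤1+n K) (m≤n+m (suc K) x))) rest

ascending-applyUpTo : ∀ K (h : ℕ → ℕ) → (∀ i → h i < h (suc i)) →
                      ∀ k → h k < K → Ascending K (h 0) K (applyUpTo h (suc k) ++ K ∷ [])
ascending-applyUpTo K h increasing zero    hk<K = ascending-cons hk<K single
ascending-applyUpTo K h increasing (suc k) hk<K =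
  ascending-cons (increasing 0) (ascending-applyUpTo K (h ∘ suc) (increasing ∘ suc) k hk<K)

module Refine {n : ℕ} (p : Fin n → Fin n) (u : Fin n) (K : ℕ)
              (climb-injective : ∀ {x y} → x < y → y ≤ K → iter p x u ≢ iter p y u) where

  open Procedure p using (insertPass; RepeatUntilStable; stable; again)

  climb : ℕ → Fin n
  climb x = iter p x u

  insertPass-climb : ∀ {N x z l} → Ascending N x z l → z ≤ K →
                     insertPass (map climb l) ≡ map climb (fillGaps l)
  insertPass-climb single _ = refl
  insertPass-climb (step {l = []} _ _ ())
  insertPass-climb (step {x = x} {y} {l = _ ∷ _} x<y _ rest) z≤K with ascending-head rest
  ... | refl with y ≟ suc x
  ... | yes refl rewrite isYes-true (climb (suc x) ≟ᶠ climb (suc x)) refl =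
    cong (climb x ∷_) (insertPass-climb rest z≤K)
  ... | no y≢1+x
    rewrite isYes-false (climb y ≟ᶠ climb (suc x))
              (climb-injective (≤∧≢⇒< x<y (y≢1+x ∘ sym)) (≤-trans (ascending-≤ rest) z≤K) ∘ sym) =
    cong (λ l → climb x ∷ climb (suc x) ∷ l) (insertPass-climb rest z≤K)

  insertPass-unit : ∀ {x z l} → Ascending 0 x z l → z ≤ K → insertPass (map climb l) ≡ map climb l
  insertPass-unit asc z≤K = trans (insertPass-climb asc z≤K) (cong (map climb) (fillGaps-unit asc))

  repeat-terminates : ∀ {N x z l} → Ascending N x z l → z ≤ K → ∃ (RepeatUntilStable (map climb l))
  repeat-terminates {zero} asc z≤K = _ , stable (insertPass-unit asc z≤K)
  repeat-terminates {suc N} {l = l} asc z≤K with ≡-dec _≟ᶠ_ (insertPass (map climb l)) (map climb l)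
  ... | yes unchanged = _ , stable unchanged
  ... | no changed =
    let B , repeat = repeat-terminates (fillGaps-narrows asc) z≤K
    in B , again changed (subst (λ A → RepeatUntilStable A B) (sym (insertPass-climb asc z≤K)) repeat)

  repeat-result : ∀ {N x z l A B} → Ascending N x z l → z ≤ K → A ≡ map climb l →
                  RepeatUntilStable A B → B ≡ map climb (applyUpTo (x +_) (suc (z ∸ x)))
  repeat-result {l = l} asc z≤K refl (stable unchanged) =
    cong (map climb) (ascending-unit-range (fillGaps-length-≡ asc same-length))
    where
    open ≡-Reasoning
    same-length : length (fillGaps l) ≡ length l
    same-length = begin
      length (fillGaps l)              ≡⟨ length-map climb (fillGaps l) ⟨
      length (map climb (fillGaps l))  ≡⟨ cong length (insertPass-climb asc z≤K) ⟨
      length (insertPass (map climb l)) ≡⟨ cong length unchanged ⟩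
      length (map climb l)             ≡⟨ length-map climb l ⟩
      length l                         ∎
  repeat-result {zero}  asc z≤K refl (again changed _) = contradiction (insertPass-unit asc z≤K) changed
  repeat-result {suc N} asc z≤K refl (again _ repeat) =
    repeat-result (fillGaps-narrows asc) z≤K (insertPass-climb asc z≤K) repeat

module LongQuery {n : ℕ} (p : Fin n → Fin n)
                 (reaches-root : ∀ v → ∃ λ i → p (iter p i v) ≡ iter p i v)
                 (u v : Fin n) (v-ancestor : ∃ λ i → iter p i u ≡ v)
                 (deep : 2 ≤ Procedure.depth p)
                 (long : ¬ (Procedure.dep p u ∸ Procedure.dep p v ≤ 2 * Procedure.t p)) where

  open Procedure p
  open Climb p reaches-root u v v-ancestor
  open Refine p u K climb-injective using (repeat-terminates; repeat-result)

  t≥1 : 1 ≤ t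
  t≥1 = ⌈log₂⌉-mono-≤ deep

  instance
    t-nonZero : NonZero t
    t-nonZero = >-nonZero t≥1

  2t<K : 2 * t < K
  2t<K = subst (2 * t <_) dep-u∸dep-v (≰⇒> long)

  D≤depth : D ≤ depth
  D≤depth = subst (_≤ depth) (dep-climb 0) (∈⇒≤-foldr-⊔ dep (allFin n) (∈-allFin u))

  j₀ : ℕ
  j₀ = t + D % t

  j₀<2t : j₀ < 2 * t
  j₀<2t = <-≤-trans (+-monoʳ-< t (m%n<n D t)) (≤-reflexive (cong (t +_) (sym (+-identityʳ t))))

  j₀<K : j₀ < K
  j₀<K = <-trans j₀<2t 2t<K

  D∸j₀+t≤depth : D ∸ j₀ + t ≤ depth
  D∸j₀+t≤depth = ≤-trans (+-monoʳ-≤ (D ∸ j₀) (m≤m+n t (D % t)))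
                         (≤-trans (≤-reflexive (m∸n+n≡m j₀≤D)) D≤depth)
    where j₀≤D = <⇒≤ (<-≤-trans j₀<K K≤D)

  climb-j₀-in-V' : inV' (climb j₀) ≡ true
  climb-j₀-in-V'
    rewrite dep-climb j₀
          | isYes-true (t ∣? (D ∸ j₀)) (n∣m∸[n+m%n] D t)
          | isYes-true (D ∸ j₀ + t ≤? depth) D∸j₀+t≤depth = refl

  j : ℕ
  j = searchFrom (λ i → inV' (iter p i u)) 1 (2 * t)

  j<K : j < K
  j<K = ≤-<-trans (searchFrom-≤ _ climb-j₀-in-V' (≤-trans t≥1 (m≤m+n t (D % t))) (m<n⇒m<1+n j₀<2t)) j₀<K

  position : ℕ → ℕ
  position a = a * t + j

  climb-position : ∀ i → iter p' i (climb j) ≡ climb (position i)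
  climb-position i = trans (iter-* p t i (climb j)) (iter-+ p (i * t) j u)

  g-position : ∀ k a → g k (climb (position a)) ≡ climb (position (2 ^ k + a))
  g-position k a = begin
    g k (climb (position a))              ≡⟨ cong (g k) (climb-position a) ⟨
    iter p' (2 ^ k) (iter p' a (climb j)) ≡⟨ iter-+ p' (2 ^ k) a (climb j) ⟩
    iter p' (2 ^ k + a) (climb j)         ≡⟨ climb-position (2 ^ k + a) ⟩
    climb (position (2 ^ k + a))          ∎
    where open ≡-Reasoning

  GridPointBeforeV : Fin n → Set
  GridPointBeforeV w = ∃ λ a → w ≡ climb (position a) × position a < K

  jumpStep-stays : ∀ k w → GridPointBeforeV w → GridPointBeforeV (jumpStep v k w)
  jumpStep-stays k _ (a , refl , before) with suc (dep v) ≤? dep (g k (climb (position a)))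
  ... | yes deeper = 2 ^ k + a , g-position k a ,
                     deeper-than-v⇒below-K _ (subst (λ w → dep v < dep w) (g-position k a) deeper)
  ... | no _ = a , refl , before

  jumpLoop-stays : ∀ m w → GridPointBeforeV w → GridPointBeforeV (jumpLoop v m w)
  jumpLoop-stays zero    w on-grid = on-grid
  jumpLoop-stays (suc m) w on-grid = jumpLoop-stays m (jumpStep v m w) (jumpStep-stays m w on-grid)

  v'-on-grid : GridPointBeforeV (v'of u v)
  v'-on-grid = jumpLoop-stays (suc t) (climb j) (0 , refl , j<K)

  jumps : ℕ
  jumps = searchFrom (λ i → eqᶠ (iter p' i (climb j)) (v'of u v)) 0 (suc n)

  jumps-before-v : position jumps < K
  jumps-before-v = ≤-<-trans (+-monoˡ-≤ j (*-monoˡ-≤ t jumps≤a)) a-before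
    where
    a        = proj₁ v'-on-grid
    a-at-v'  = proj₁ (proj₂ v'-on-grid)
    a-before = proj₂ (proj₂ v'-on-grid)
    a<1+n    = m<n⇒m<1+n (≤-<-trans (≤-trans (m≤m*n a t) (m≤m+n (a * t) j)) (<-trans a-before K<n))
    jumps≤a : jumps ≤ a
    jumps≤a  = searchFrom-≤ (λ i → eqᶠ (iter p' i (climb j)) (v'of u v))
                 (isYes-true (iter p' a (climb j) ≟ᶠ v'of u v) (trans (climb-position a) (sym a-at-v')))
                 z≤n a<1+n

  indices : List ℕ
  indices = 0 ∷ applyUpTo position (suc jumps) ++ K ∷ []

  indices-ascending : Ascending K 0 K indices
  indices-ascending = ascending-cons (searchFrom-≥ (λ i → inV' (iter p i u)) 1 (2 * t))
    (ascending-applyUpTo K position (λ i → +-monoˡ-< j (m<n+m (i * t) t≥1)) jumps jumps-before-v)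

  initialA-indices : initialA u v ≡ map climb indices
  initialA-indices = cong (u ∷_) (begin
    pathIn p' (climb j) (v'of u v) ++ v ∷ []
      ≡⟨ cong₂ _++_ path-on-grid (cong (_∷ []) (sym climb-K)) ⟩
    map climb (applyUpTo position (suc jumps)) ++ map climb (K ∷ [])
      ≡⟨ map-++ climb (applyUpTo position (suc jumps)) (K ∷ []) ⟨
    map climb (applyUpTo position (suc jumps) ++ K ∷ []) ∎)
    where
    open ≡-Reasoning
    path-on-grid : pathIn p' (climb j) (v'of u v) ≡ map climb (applyUpTo position (suc jumps))
    path-on-grid = trans (map-cong climb-position (upTo (suc jumps)))
                   (trans (map-upTo (climb ∘ position) (suc jumps))
                          (sym (map-applyUpTo position climb (suc jumps))))

  repeat-stops : ∃ (RepeatUntilStable (initialA u v))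
  repeat-stops = subst (λ A → ∃ (RepeatUntilStable A)) (sym initialA-indices)
                       (repeat-terminates indices-ascending ≤-refl)

  repeat-yields-path : ∀ {B} → RepeatUntilStable (initialA u v) B → B ≡ map climb (upTo (suc K))
  repeat-yields-path = repeat-result indices-ascending ≤-refl initialA-indices

-- The argument never uses that the root is unique.
lemma5 : (n : ℕ) (p : Fin n → Fin n) →
    (∀ v → ∃ λ i → p (iter p i v) ≡ iter p i v) →
    (∀ r r' → p r ≡ r → p r' ≡ r' → r ≡ r') →
    2 ≤ Procedure.depth p →
    (q : ℕ) (Q : Fin q → Fin n × Fin n) →
    (∀ j → ∃ λ i → iter p i (proj₁ (Q j)) ≡ proj₂ (Q j)) →
    ∀ j →
      (∃ λ P → Procedure.MultiPathsOut p (proj₁ (Q j)) (proj₂ (Q j)) P) ×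
      (∀ P → Procedure.MultiPathsOut p (proj₁ (Q j)) (proj₂ (Q j)) P →
        ∃ λ k → iter p k (proj₁ (Q j)) ≡ proj₂ (Q j) ×
          (∀ i → i < k → ¬ (iter p i (proj₁ (Q j)) ≡ proj₂ (Q j))) ×
          P ≡ map (λ i → iter p i (proj₁ (Q j))) (upTo (suc k)))
lemma5 n p reaches-root _ deep q Q ancestor j = output-exists , output-is-path
  where
  u = proj₁ (Q j)
  v = proj₂ (Q j)
  open Procedure p
  open Climb p reaches-root u v (ancestor j)
  module Long = LongQuery p reaches-root u v (ancestor j) deep

  output-exists : ∃ (MultiPathsOut u v)
  output-exists with dep u ∸ dep v ≤? 2 * t
  ... | yes short = _ , caseA short
  ... | no long   = _ , caseB long (proj₂ (Long.repeat-stops long))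

  output-is-path : ∀ P → MultiPathsOut u v P →
                   ∃ λ k → climb k ≡ v × (∀ i → i < k → climb i ≢ v) × P ≡ map climb (upTo (suc k))
  output-is-path _ (caseA _)           = K , climb-K , K-first , pathIn-climb
  output-is-path _ (caseB long repeat) = K , climb-K , K-first , Long.repeat-yields-path long repeat
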